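{- Let $G$ be a digraph, let $k\in\mathbb{N}$, and let $T\subseteq V(G)$ be a vertex set such that every non-trivial strong component of $G-T$ is 1-out-regular. Let $Z\subseteq V(G)$ satisfy $Z\cap T=\emptyset$, and suppose $G[Z\cup T]$ has no subgraph in $\mathcal{F}$. Let $G'=\mathsf{torso}(G,Z)$. Then for every $S\subseteq V(G)\setminus(Z\cup T)$, the digraph $G-S$ contains a subdigraph in $\mathcal{F}$ if and only if $G'-S$ contains a subdigraph in $\mathcal{F}_{\mathsf{bad}}$.
   Context: A digraph is strong if it is a single vertex (trivial) or there is a directed path between any two distinct vertices in each direction. It is 1-out-regular if every vertex has out-degree exactly 1. $\mathcal{F}$ is the family of strong subdigraphs of $G$ that are non-trivial and are not a simple directed cycle. The torso: $\mathsf{torso}(G,Z)$ is the digraph with vertex set $V(G)\setminus Z$ that contains an arc $(u,v)$, for $u,v\notin Z$, whenever $G$ has a $u\to v$ path of length at least 1 whose internal vertices all lie in $Z$. Self-loops are allowed. Such an arc is good if this path $P$ is unique and no cycle $O$ of $G[Z]$ intersects $P$; otherwise it is bad. A cycle of the torso is good if all its arcs are good. $\mathcal{F}_{\mathsf{bad}}$ is the family of strong subdigraphs of $\mathsf{torso}(G,Z)$ that are neither trivial nor a good cycle. -}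

module Defs where

open import Data.Nat using (ℕ; suc)
open import Data.Fin using (Fin)
open import Data.Fin using (toℕ; fromℕ<)
open import Data.Nat.DivMod using (_%_; m%n<n)
open import Data.Bool using (Bool; true; false; _∨_)
open import Data.List using (List; []; _∷_)
open import Data.List.Relation.Unary.All using (All)
open import Data.List.Relation.Unary.Unique.Propositional using (Unique)
open import Data.List.Membership.Propositional using (_∈_)
open import Data.Product using (Σ; ∃; ∃-syntax; _×_; _,_)
open import Data.Unit using (⊤)
open import Data.Empty using (⊥)
open import Relation.Nullary using (¬_)
open import Relation.Binary.PropositionalEquality using (_≡_; _≢_)
open import Relation.Binary.Construct.Closure.ReflexiveTransitive using (Star)
open import Function.Definitions using (Injective)

-- Ambient finite digraph: vertices Fin n, arcs given by a Boolean
-- adjacency function (loops allowed, no parallel arcs).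
-- Vertex sets (S, T, Z) are Boolean predicates on Fin n.

Adj : ℕ → Set
Adj n = Fin n → Fin n → Bool

VSet : ℕ → Set
VSet n = Fin n → Bool

record Digraph (n : ℕ) : Set₁ where
  field
    V : Fin n → Set
    A : Fin n → Fin n → Set
open Digraph public

toDigraph : ∀ {n} → Adj n → Digraph n
toDigraph E = record { V = λ _ → ⊤ ; A = λ x y → E x y ≡ true }

_－_ : ∀ {n} → Digraph n → VSet n → Digraph n
D － S = record
  { V = λ x → V D x × S x ≡ false
  ; A = λ x y → A D x y × S x ≡ false × S y ≡ false }

_[_] : ∀ {n} → Digraph n → VSet n → Digraph n
D [ C ] = record
  { V = λ x → V D x × C x ≡ true
  ; A = λ x y → A D x y × C x ≡ true × C y ≡ true }

_∪_ : ∀ {n} → VSet n → VSet n → VSet n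
(X ∪ Y) x = X x ∨ Y x

record Sub (n : ℕ) : Set where
  field
    hv : Fin n → Bool
    ha : Fin n → Fin n → Bool
open Sub public

SubOf : ∀ {n} → Digraph n → Sub n → Set
SubOf D H =
  (∀ x → hv H x ≡ true → V D x) ×
  (∀ x y → ha H x y ≡ true → hv H x ≡ true × hv H y ≡ true × A D x y)

ReachH : ∀ {n} → Sub n → Fin n → Fin n → Set
ReachH H = Star (λ a b → ha H a b ≡ true)

Strong : ∀ {n} → Sub n → Set
Strong H =
  (∃[ x ] hv H x ≡ true) ×
  (∀ x y → hv H x ≡ true → hv H y ≡ true → x ≢ y → ReachH H x y)

Trivial : ∀ {n} → Sub n → Set
Trivial H =
  ∃[ x ] ((∀ y → hv H y ≡ true → y ≡ x) × hv H x ≡ true ×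
          (∀ a b → ha H a b ≡ false))

next : ∀ {k} → Fin (suc k) → Fin (suc k)
next {k} i = fromℕ< (m%n<n (suc (toℕ i)) (suc k))

-- H is a simple directed cycle v₀ → v₁ → … → v_k → v₀ (length k+1 ≥ 1;
-- length 1 is a self-loop)
IsCycle : ∀ {n} → Sub n → Set
IsCycle {n} H =
  Σ ℕ λ k → Σ (Fin (suc k) → Fin n) λ c →
    Injective _≡_ _≡_ c ×
    (∀ x → (hv H x ≡ true → ∃[ i ] c i ≡ x) × (∀ i → c i ≡ x → hv H x ≡ true)) ×
    (∀ x y → (ha H x y ≡ true → ∃[ i ] (c i ≡ x × c (next i) ≡ y)) ×
             (∀ i → c i ≡ x → c (next i) ≡ y → ha H x y ≡ true))

InF : ∀ {n} → Digraph n → Sub n → Set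
InF D H = SubOf D H × Strong H × ¬ Trivial H × ¬ IsCycle H

Chain : ∀ {n} → Adj n → Fin n → List (Fin n) → Fin n → Set
Chain E u [] v = E u v ≡ true
Chain E u (z ∷ zs) v = E u z ≡ true × Chain E z zs v

IsZPath : ∀ {n} → Adj n → VSet n → Fin n → Fin n → List (Fin n) → Set
IsZPath E Z u v zs = All (λ z → Z z ≡ true) zs × Unique zs × Chain E u zs v

torso : ∀ {n} → Adj n → VSet n → Digraph n
torso E Z = record
  { V = λ x → Z x ≡ false
  ; A = λ u v → Z u ≡ false × Z v ≡ false × ∃[ zs ] IsZPath E Z u v zs }

-- a torso arc (u,v) is good: the path P is unique and no cycle O of
-- G[Z] intersects P (P's endpoints are outside Z, so an intersection
-- is at an internal vertex)
GoodArc : ∀ {n} → Adj n → VSet n → Fin n → Fin n → Set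
GoodArc {n} E Z u v =
  ∃[ zs ] (IsZPath E Z u v zs ×
           (∀ zs′ → IsZPath E Z u v zs′ → zs′ ≡ zs) ×
           (∀ (O : Sub n) → SubOf (toDigraph E [ Z ]) O → IsCycle O →
              ∀ z → z ∈ zs → hv O z ≡ false))

GoodCycle : ∀ {n} → Adj n → VSet n → Sub n → Set
GoodCycle E Z H = IsCycle H × (∀ x y → ha H x y ≡ true → GoodArc E Z x y)

-- the family 𝓕_bad, relative to a digraph D which is a subdigraph of
-- torso(G,Z) (e.g. torso(G,Z) - S)
InFbad : ∀ {n} → Adj n → VSet n → Digraph n → Sub n → Set
InFbad E Z D H = SubOf D H × Strong H × ¬ Trivial H × ¬ GoodCycle E Z H

Reach : ∀ {n} → Digraph n → Fin n → Fin n → Set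
Reach D = Star (λ a b → V D a × V D b × A D a b)

InComp : ∀ {n} → Digraph n → Fin n → Fin n → Set
InComp D v w = V D w × Reach D v w × Reach D w v

NontrivCompsOutRegular : ∀ {n} → Digraph n → Set
NontrivCompsOutRegular D =
  ∀ v → V D v →
    (∃[ x ] ∃[ y ] (InComp D v x × InComp D v y × A D x y)) →
    ∀ w → InComp D v w →
      ∃[ y ] ((InComp D v y × A D w y) ×
              (∀ y′ → InComp D v y′ → A D w y′ → y′ ≡ y))

-- Write u ↝ v for the arcs of G − S, and call w a fork of G − S if it has two distinct
-- out-neighbours that both lead back to w.  If G − S has a fork, the strong component of w is
-- strong, non-trivial and branches at w, so it belongs to 𝓕.  If it has none, a strong
-- subgraph H of torso(G,Z) − S cannot branch: two torso arcs x → y₁, x → y₂ with different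
-- Z-paths split at some vertex of G − S, and that vertex is a fork because y₁ and y₂ lead back
-- to x in H.  Hence H is a cycle, and by the same argument every arc of H has a unique Z-path
-- that meets no cycle of G[Z]; so H is a good cycle and 𝓕_bad is empty.
--
-- Conversely let H ∈ 𝓕 lie in G − S.  Since G[Z] contains no member of 𝓕, H leaves Z, and
-- contracting the Z-stretches of H yields a strong non-trivial subgraph of the torso.  Were it
-- a good cycle, a branching w → p₁, w → p₂ of H would give two Z-walks between the ends of one
-- good arc; but a good arc admits only one Z-walk, since a repeated vertex on a Z-walk closes a
-- cycle of G[Z] through its path.  So H would not branch and would be a cycle, contrary to
-- H ∈ 𝓕.

module Submission where

open import Defs
open import Data.Nat using (ℕ; zero; suc; _≤_; _<_; z≤n; s≤s)
open import Data.Nat.Induction using (<-wellFounded)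
open import Data.Nat.DivMod using (_%_; m<n⇒m%n≡m; n%n≡0)
open import Data.Bool using (Bool; true; false)
open import Data.Bool.Properties using () renaming (_≟_ to _≟ᵇ_)
open import Data.Fin using (Fin; zero; suc; toℕ; fromℕ; inject₁; _≟_)
open import Data.Fin.Properties using (any?; toℕ-injective; toℕ<n; toℕ-fromℕ<; toℕ-fromℕ; toℕ-inject₁; injective⇒≤)
open import Data.Fin.Induction using (<-weakInduction; >-weakInduction)
open import Data.Fin.Relation.Unary.Top using (view; ‵fromℕ; ‵inject₁)
open import Data.List using (List; []; _∷_; _++_; length; lookup)
open import Data.List.Properties using (length-++-≤ʳ; ++-assoc; ≡-dec; ++-cancelˡ)
open import Data.List.Relation.Unary.All as All using (All; []; _∷_; head; tail)
open import Data.List.Relation.Unary.AllPairs using ([]; _∷_)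
open import Data.List.Relation.Unary.All.Properties using (¬Any⇒All¬; anti-mono; ++⁺; ++⁻ˡ; ++⁻ʳ)
open import Data.List.Relation.Unary.Unique.Propositional using (Unique)
open import Data.List.Membership.Propositional using (_∈_)
open import Data.List.Membership.Propositional.Properties using (∈-lookup; ∈-++⁻; ∈-++⁺ˡ; ∈-++⁺ʳ; ∈-∃++)
open import Data.List.Relation.Unary.Any using (here; there)
open import Data.List.Relation.Binary.Subset.Propositional using (_⊆_)
open import Data.Product using (∃-syntax; _×_; _,_; proj₁; proj₂)
open import Data.Sum using (_⊎_; inj₁; inj₂)
open import Function using (id; _∘_)
open import Function.Definitions using (Injective)
open import Function.Bundles using (_⇔_; mk⇔)
open import Induction.WellFounded using (WellFounded; Acc; acc)
open import Relation.Binary.Construct.On as On using ()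
open import Relation.Binary.Definitions using (DecidableEquality)
open import Relation.Binary.PropositionalEquality using (_≡_; _≢_; refl; sym; trans; cong; cong₂; subst; module ≡-Reasoning)
open import Relation.Binary.Construct.Closure.ReflexiveTransitive using (Star; ε; _◅_; _◅◅_; fold; map; concat)
open import Relation.Nullary using (¬_; ¬?; Dec; yes; no; does; contradiction)
open import Relation.Nullary.Decidable using (_×-dec_; _⊎-dec_; dec-true)

-- Walks with a list of internal vertices

Ch : {A : Set} → (A → A → Set) → A → List A → A → Set
Ch R u []       v = R u v
Ch R u (z ∷ zs) v = R u z × Ch R z zs v

module _ {A : Set} {R : A → A → Set} where

  Ch-++⁻ : ∀ p {z r u v} → Ch R u (p ++ z ∷ r) v → Ch R u p z × Ch R z r v
  Ch-++⁻ []      (a , c) = a , c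
  Ch-++⁻ (_ ∷ p) (a , c) = let (c₁ , c₂) = Ch-++⁻ p c in (a , c₁) , c₂

  Ch-++⁺ : ∀ p {z r u v} → Ch R u p z → Ch R z r v → Ch R u (p ++ z ∷ r) v
  Ch-++⁺ []      a        c  = a , c
  Ch-++⁺ (_ ∷ p) (a , c₁) c₂ = a , Ch-++⁺ p c₁ c₂

  Ch-removeLoop : ∀ p {z} m {s u v} → Ch R u (p ++ z ∷ m ++ z ∷ s) v →
                  Ch R u (p ++ z ∷ s) v × Ch R z m z
  Ch-removeLoop p m c =
    let (c₁ , c₂) = Ch-++⁻ p c ; (c₃ , c₄) = Ch-++⁻ m c₂
    in Ch-++⁺ p c₁ c₄ , c₃

  Ch⇒Star : ∀ zs {u v} → Ch R u zs v → Star R u v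
  Ch⇒Star []       r       = r ◅ ε
  Ch⇒Star (_ ∷ zs) (r , c) = r ◅ Ch⇒Star zs c

  Star⇒Ch : ∀ {u v} → Star R u v → u ≡ v ⊎ ∃[ zs ] Ch R u zs v
  Star⇒Ch ε = inj₁ refl
  Star⇒Ch (r ◅ rs) with Star⇒Ch rs
  ... | inj₁ refl      = inj₂ ([] , r)
  ... | inj₂ (zs , c) = inj₂ (_ ∷ zs , r , c)

  closedCh : ∀ {x y} → R x y → Star R y x → ∃[ m ] Ch R x m x
  closedCh r rs with Star⇒Ch rs
  ... | inj₁ refl      = [] , r
  ... | inj₂ (zs , c) = _ ∷ zs , r , c

Ch-map : ∀ {A : Set} {R R′ : A → A → Set} → (∀ {a b} → R a b → R′ a b) →
         ∀ {u} zs {v} → Ch R u zs v → Ch R′ u zs v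
Ch-map f []       r       = f r
Ch-map f (_ ∷ zs) (r , c) = f r , Ch-map f zs c

Star-preserves : ∀ {A : Set} {R : A → A → Set} {P : A → Set} →
                 (∀ {a b} → R a b → P a → P b) → ∀ {x y} → Star R x y → P x → P y
Star-preserves {P = P} step = fold (λ a b → P a → P b) (λ r f → f ∘ step r) id

Duplicate : {A : Set} → List A → Set
Duplicate xs = ∃[ p ] ∃[ z ] ∃[ m ] ∃[ s ] xs ≡ p ++ z ∷ m ++ z ∷ s

module _ {A : Set} where

  _⋖_ : List A → List A → Set
  xs ⋖ ys = length xs < length ys

  ⋖-wellFounded : WellFounded _⋖_
  ⋖-wellFounded = On.wellFounded length <-wellFounded

  prefix-⋖ : ∀ p {z : A} s → p ⋖ (p ++ z ∷ s)
  prefix-⋖ []      s = s≤s z≤n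
  prefix-⋖ (_ ∷ p) s = s≤s (prefix-⋖ p s)

  removeLoop-⋖ : ∀ p {z : A} m s → (p ++ z ∷ s) ⋖ (p ++ z ∷ m ++ z ∷ s)
  removeLoop-⋖ []      {z} m s = s≤s (length-++-≤ʳ (z ∷ s) {m})
  removeLoop-⋖ (_ ∷ p)     m s = s≤s (removeLoop-⋖ p m s)

  removeLoop-⊆ : ∀ p {z : A} m {s} → (p ++ z ∷ s) ⊆ (p ++ z ∷ m ++ z ∷ s)
  removeLoop-⊆ p m x∈ with ∈-++⁻ p x∈
  ... | inj₁ x∈p         = ∈-++⁺ˡ x∈p
  ... | inj₂ (here refl) = ∈-++⁺ʳ p (here refl)
  ... | inj₂ (there x∈s) = ∈-++⁺ʳ p (there (∈-++⁺ʳ m (there x∈s)))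

module _ {A : Set} (_≟_ : DecidableEquality A) where
  open import Data.List.Membership.DecPropositional _≟_ using (_∈?_)

  unique⊎duplicate : (xs : List A) → Unique xs ⊎ Duplicate xs
  unique⊎duplicate [] = inj₁ []
  unique⊎duplicate (x ∷ xs) with x ∈? xs
  ... | yes x∈ = let (m , s , eq) = ∈-∃++ x∈ in inj₂ ([] , x , m , s , cong (x ∷_) eq)
  ... | no x∉ with unique⊎duplicate xs
  ...   | inj₁ u = inj₁ (¬Any⇒All¬ xs x∉ ∷ u)
  ...   | inj₂ (p , z , m , s , eq) = inj₂ (x ∷ p , z , m , s , cong (x ∷_) eq)

  module _ {R : A → A → Set} where

    Ch-unique : ∀ {u v} zs → Acc _⋖_ zs → Ch R u zs v →
                ∃[ zs′ ] Unique zs′ × zs′ ⊆ zs × Ch R u zs′ v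
    Ch-unique zs (acc rec) c with unique⊎duplicate zs
    ... | inj₁ u = zs , u , id , c
    ... | inj₂ (p , z , m , s , refl) =
      let (zs′ , u , sub , c′) = Ch-unique (p ++ z ∷ s) (rec (removeLoop-⋖ p m s))
                                            (proj₁ (Ch-removeLoop p m c))
      in zs′ , u , removeLoop-⊆ p m ∘ sub , c′

    Ch-uniqueCycle : ∀ {z} m → Acc _⋖_ m → Ch R z m z →
                     ∃[ m′ ] Unique (z ∷ m′) × m′ ⊆ m × Ch R z m′ z
    Ch-uniqueCycle {z} m (acc rec) c with unique⊎duplicate (z ∷ m)
    ... | inj₁ u = m , u , id , c
    ... | inj₂ ([] , _ , m′ , s , refl) =
      let (m″ , u , sub , c′) = Ch-uniqueCycle m′ (rec (prefix-⋖ m′ s)) (proj₁ (Ch-++⁻ m′ c))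
      in m″ , u , ∈-++⁺ˡ ∘ sub , c′
    ... | inj₂ (_ ∷ p , y , m′ , s , refl) =
      let (m″ , u , sub , c′) = Ch-uniqueCycle (p ++ y ∷ s) (rec (removeLoop-⋖ p m′ s))
                                               (proj₁ (Ch-removeLoop p m′ c))
      in m″ , u , removeLoop-⊆ p m′ ∘ sub , c′

-- Finite digraphs

lookup-injective : ∀ {A : Set} {xs : List A} → Unique xs → Injective _≡_ _≡_ (lookup xs)
lookup-injective {xs = x ∷ xs} (x∉ ∷ u) {zero}  {zero}  eq = refl
lookup-injective {xs = x ∷ xs} (x∉ ∷ u) {zero}  {suc j} eq =
  contradiction eq (All.lookup x∉ (∈-lookup j))
lookup-injective {xs = x ∷ xs} (x∉ ∷ u) {suc i} {zero}  eq =
  contradiction (sym eq) (All.lookup x∉ (∈-lookup i))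
lookup-injective {xs = x ∷ xs} (x∉ ∷ u) {suc i} {suc j} eq = cong suc (lookup-injective u eq)

unique⇒length≤ : ∀ {n} {xs : List (Fin n)} → Unique xs → length xs ≤ n
unique⇒length≤ u = injective⇒≤ (lookup-injective u)

module _ {n : ℕ} {R : Fin n → Fin n → Set} (R? : ∀ x y → Dec (R x y)) where

  Reach≤ : ℕ → Fin n → Fin n → Set
  Reach≤ zero    x y = x ≡ y
  Reach≤ (suc k) x y = x ≡ y ⊎ ∃[ z ] R x z × Reach≤ k z y

  reach≤? : ∀ k x y → Dec (Reach≤ k x y)
  reach≤? zero    x y = x ≟ y
  reach≤? (suc k) x y = (x ≟ y) ⊎-dec any? (λ z → R? x z ×-dec reach≤? k z y)

  Reach≤⇒Star : ∀ k {x y} → Reach≤ k x y → Star R x y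
  Reach≤⇒Star zero    refl               = ε
  Reach≤⇒Star (suc k) (inj₁ refl)        = ε
  Reach≤⇒Star (suc k) (inj₂ (_ , r , q)) = r ◅ Reach≤⇒Star k q

  Reach≤-mono : ∀ {k k′ x y} → k ≤ k′ → Reach≤ k x y → Reach≤ k′ x y
  Reach≤-mono {zero}  {zero}   _         refl = refl
  Reach≤-mono {zero}  {suc k′} _         refl = inj₁ refl
  Reach≤-mono {suc k} {suc k′} _         (inj₁ e)           = inj₁ e
  Reach≤-mono {suc k} {suc k′} (s≤s k≤k′) (inj₂ (z , r , q)) = inj₂ (z , r , Reach≤-mono k≤k′ q)

  Ch⇒Reach≤ : ∀ {x y} zs → Ch R x zs y → Reach≤ (suc (length zs)) x y
  Ch⇒Reach≤ []       r       = inj₂ (_ , r , refl)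
  Ch⇒Reach≤ (z ∷ zs) (r , c) = inj₂ (z , r , Ch⇒Reach≤ zs c)

  -- a walk shortens to one with distinct internal vertices, hence at most n + 1 arcs
  Star⇒Reach≤ : ∀ {x y} → Star R x y → Reach≤ (suc n) x y
  Star⇒Reach≤ w with Star⇒Ch w
  ... | inj₁ refl = inj₁ refl
  ... | inj₂ (zs , c) =
    let (zs′ , u , _ , c′) = Ch-unique _≟_ zs (⋖-wellFounded zs) c
    in Reach≤-mono (s≤s (unique⇒length≤ u)) (Ch⇒Reach≤ zs′ c′)

  star? : ∀ x y → Dec (Star R x y)
  star? x y with reach≤? (suc n) x y
  ... | yes q = yes (Reach≤⇒Star (suc n) q)
  ... | no ¬q = no (¬q ∘ Star⇒Reach≤)

does⇒ : ∀ {P : Set} (d : Dec P) → does d ≡ true → P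
does⇒ (yes p) _ = p

module _ {n : ℕ} {P : Fin n → Set} {Q : Fin n → Fin n → Set}
         (P? : ∀ x → Dec (P x)) (Q? : ∀ x y → Dec (Q x y)) where

  decSub : Sub n
  decSub = record { hv = λ x → does (P? x) ; ha = λ x y → does (Q? x y) }

  hv-decSub⁻ : ∀ {x} → hv decSub x ≡ true → P x
  hv-decSub⁻ = does⇒ (P? _)

  hv-decSub⁺ : ∀ {x} → P x → hv decSub x ≡ true
  hv-decSub⁺ = dec-true (P? _)

  ha-decSub⁻ : ∀ {x y} → ha decSub x y ≡ true → Q x y
  ha-decSub⁻ = does⇒ (Q? _ _)

  ha-decSub⁺ : ∀ {x y} → Q x y → ha decSub x y ≡ true
  ha-decSub⁺ = dec-true (Q? _ _)

module _ {n : ℕ} where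

  Vtx : Sub n → Fin n → Set
  Vtx H x = hv H x ≡ true

  Arc : Sub n → Fin n → Fin n → Set
  Arc H x y = ha H x y ≡ true

  ArcsJoinVertices : Sub n → Set
  ArcsJoinVertices H = ∀ {x y} → Arc H x y → Vtx H x × Vtx H y

  OutDegree≤1 : Sub n → Set
  OutDegree≤1 H = ∀ {x y₁ y₂} → Arc H x y₁ → Arc H x y₂ → y₁ ≡ y₂

  SubOf⇒ArcsJoinVertices : ∀ {D H} → SubOf D H → ArcsJoinVertices H
  SubOf⇒ArcsJoinVertices (_ , arcs) r = let (hx , hy , _) = arcs _ _ r in hx , hy

  module _ {H : Sub n} where

    Star-vertex : ArcsJoinVertices H → ∀ {x y} → Star (Arc H) x y → Vtx H x → Vtx H y
    Star-vertex arcs = Star-preserves (λ r _ → proj₂ (arcs r))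

    Strong⇒Star : Strong H → ∀ {x y} → Vtx H x → Vtx H y → Star (Arc H) x y
    Strong⇒Star (_ , reach) {x} {y} hx hy with x ≟ y
    ... | yes refl = ε
    ... | no x≢y   = reach x y hx hy x≢y

    Strong⇒outArc : Strong H → ¬ Trivial H → ArcsJoinVertices H →
                    ∀ {x} → Vtx H x → ∃[ y ] Arc H x y
    Strong⇒outArc strong nontrivial arcs {x} hx with any? (λ y → ha H x y ≟ᵇ true)
    ... | yes arc = arc
    ... | no noArc = contradiction (x , onlyX , hx , noArcs) nontrivial
      where
      onlyX : ∀ y → Vtx H y → y ≡ x
      onlyX y hy with Strong⇒Star strong hx hy
      ... | ε     = refl
      ... | r ◅ _ = contradiction (_ , r) noArc
      noArcs : ∀ a b → ha H a b ≡ false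
      noArcs a b with ha H a b in e
      ... | false = refl
      ... | true with onlyX a (proj₁ (arcs e))
      ...   | refl = contradiction (b , e) noArc

-- Cycles

next-inject₁ : ∀ {k} (j : Fin k) → next (inject₁ j) ≡ suc j
next-inject₁ {k} j = toℕ-injective (begin
  toℕ (next (inject₁ j))       ≡⟨ toℕ-fromℕ< _ ⟩
  suc (toℕ (inject₁ j)) % suc k ≡⟨ cong (λ t → suc t % suc k) (toℕ-inject₁ j) ⟩
  suc (toℕ j) % suc k          ≡⟨ m<n⇒m%n≡m (s≤s (toℕ<n j)) ⟩
  suc (toℕ j)                  ∎)
  where open ≡-Reasoning

next-fromℕ : ∀ k → next (fromℕ k) ≡ zero
next-fromℕ k = toℕ-injective (begin
  toℕ (next (fromℕ k))       ≡⟨ toℕ-fromℕ< _ ⟩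
  suc (toℕ (fromℕ k)) % suc k ≡⟨ cong (λ t → suc t % suc k) (toℕ-fromℕ k) ⟩
  suc k % suc k              ≡⟨ n%n≡0 (suc k) ⟩
  0                          ∎)
  where open ≡-Reasoning

module _ {A : Set} {R : A → A → Set} {k : ℕ} (c : Fin (suc k) → A)
         (step : ∀ i → R (c i) (c (next i))) where

  cyclic⇒Star : ∀ i j → Star R (c i) (c j)
  cyclic⇒Star i j = toLast i ◅◅ wrap ◅ fromZero j
    where
    forward : ∀ i → R (c (inject₁ i)) (c (suc i))
    forward i = subst (R (c (inject₁ i)) ∘ c) (next-inject₁ i) (step (inject₁ i))
    wrap : R (c (fromℕ k)) (c zero)
    wrap = subst (R (c (fromℕ k)) ∘ c) (next-fromℕ k) (step (fromℕ k))
    fromZero : ∀ j → Star R (c zero) (c j)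
    fromZero = <-weakInduction (λ j → Star R (c zero) (c j)) ε
                 (λ i p → p ◅◅ forward i ◅ ε)
    toLast : ∀ i → Star R (c i) (c (fromℕ k))
    toLast = >-weakInduction (λ i → Star R (c i) (c (fromℕ k))) ε
               (λ i p → forward i ◅ p)

module _ {A : Set} {R : A → A → Set} where

  Ch-lookup-inner : ∀ {a b} xs → Ch R a xs b →
                    ∀ j → R (lookup (a ∷ xs) (inject₁ j)) (lookup (a ∷ xs) (suc j))
  Ch-lookup-inner (_ ∷ xs) (r , c) zero    = r
  Ch-lookup-inner (_ ∷ xs) (r , c) (suc j) = Ch-lookup-inner xs c j

  Ch-lookup-last : ∀ {a b} xs → Ch R a xs b → R (lookup (a ∷ xs) (fromℕ (length xs))) b
  Ch-lookup-last []       r       = r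
  Ch-lookup-last (_ ∷ xs) (_ , c) = Ch-lookup-last xs c

  Ch-cyclic : ∀ {z} m → Ch R z m z → ∀ i → R (lookup (z ∷ m) i) (lookup (z ∷ m) (next i))
  Ch-cyclic {z} m c i with view i
  ... | ‵fromℕ     = subst (R (lookup (z ∷ m) i) ∘ lookup (z ∷ m)) (sym (next-fromℕ _)) (Ch-lookup-last m c)
  ... | ‵inject₁ j = subst (R (lookup (z ∷ m) i) ∘ lookup (z ∷ m)) (sym (next-inject₁ j)) (Ch-lookup-inner m c j)

module _ {n : ℕ} {H : Sub n} where

  IsCycle⇒OutDegree≤1 : IsCycle H → OutDegree≤1 H
  IsCycle⇒OutDegree≤1 (_ , c , inj , _ , arcs) {x} a₁ a₂ =
    let (i , ci , cni) = proj₁ (arcs x _) a₁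
        (j , cj , cnj) = proj₁ (arcs x _) a₂
    in trans (sym cni) (trans (cong (c ∘ next) (inj (trans ci (sym cj)))) cnj)

  IsCycle⇒outArc : IsCycle H → ∀ {x} → Vtx H x → ∃[ y ] Arc H x y
  IsCycle⇒outArc (_ , c , _ , vs , arcs) hx =
    let (i , ci) = proj₁ (vs _) hx in c (next i) , proj₂ (arcs _ _) i ci refl

  IsCycle⇒ArcsJoinVertices : IsCycle H → ArcsJoinVertices H
  IsCycle⇒ArcsJoinVertices (_ , c , _ , vs , arcs) r with proj₁ (arcs _ _) r
  ... | i , refl , refl = proj₂ (vs _) i refl , proj₂ (vs _) (next i) refl

  IsCycle⇒Star : IsCycle H → ∀ {x y} → Vtx H x → Vtx H y → Star (Arc H) x y
  IsCycle⇒Star (_ , c , _ , vs , arcs) hx hy with proj₁ (vs _) hx | proj₁ (vs _) hy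
  ... | i , refl | j , refl = cyclic⇒Star c (λ i → proj₂ (arcs _ _) i refl refl) i j

  module _ (arcs : ArcsJoinVertices H) (outDeg : OutDegree≤1 H) where

    uniqueClosedCh⇒IsCycle : ∀ {x₀} m → Unique (x₀ ∷ m) → Ch (Arc H) x₀ m x₀ →
                             (∀ {x} → Vtx H x → Star (Arc H) x₀ x) → IsCycle H
    uniqueClosedCh⇒IsCycle {x₀} m u ch reach =
      length m , c , lookup-injective u , vertices , arcsOnCycle
      where
      c : Fin (suc (length m)) → Fin n
      c = lookup (x₀ ∷ m)
      step : ∀ i → Arc H (c i) (c (next i))
      step = Ch-cyclic m ch
      closed : ∀ {a b} → Arc H a b → ∃[ i ] c i ≡ a → ∃[ i ] c i ≡ b
      closed r (i , refl) = next i , outDeg (step i) r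
      vertices : ∀ x → (Vtx H x → ∃[ i ] c i ≡ x) × (∀ i → c i ≡ x → Vtx H x)
      vertices x = (λ hx → Star-preserves closed (reach hx) (zero , refl)) ,
                   (λ { i refl → proj₁ (arcs (step i)) })
      arcsOnCycle : ∀ x y → (Arc H x y → ∃[ i ] c i ≡ x × c (next i) ≡ y) ×
                            (∀ i → c i ≡ x → c (next i) ≡ y → Arc H x y)
      arcsOnCycle x y = (λ r → onward (proj₁ (vertices x) (proj₁ (arcs r))) r) ,
                        (λ { i refl refl → step i })
        where
        onward : ∃[ i ] c i ≡ x → Arc H x y → ∃[ i ] c i ≡ x × c (next i) ≡ y
        onward (i , refl) r = i , refl , outDeg (step i) r

    functionalStrong⇒IsCycle : Strong H → ¬ Trivial H → IsCycle H
    functionalStrong⇒IsCycle strong nontrivial =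
      let (x₀ , h₀) = proj₁ strong
          (y₀ , r) = Strong⇒outArc strong nontrivial arcs h₀
          (m₀ , ch₀) = closedCh r (Strong⇒Star strong (proj₂ (arcs r)) h₀)
          (m , u , _ , ch) = Ch-uniqueCycle _≟_ m₀ (⋖-wellFounded m₀) ch₀
      in uniqueClosedCh⇒IsCycle m u ch (Strong⇒Star strong h₀)

module _ {n k : ℕ} (c : Fin (suc k) → Fin n) where

  private
    onCycle? : ∀ x → Dec (∃[ i ] c i ≡ x)
    onCycle? x = any? λ i → c i ≟ x

    cycleArc? : ∀ x y → Dec (∃[ i ] c i ≡ x × c (next i) ≡ y)
    cycleArc? x y = any? λ i → (c i ≟ x) ×-dec (c (next i) ≟ y)

  cycleSub : Sub n
  cycleSub = decSub onCycle? cycleArc?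

  cycleSub-vertex⁻ : ∀ {x} → Vtx cycleSub x → ∃[ i ] c i ≡ x
  cycleSub-vertex⁻ = hv-decSub⁻ onCycle? cycleArc?

  cycleSub-vertex⁺ : ∀ i → Vtx cycleSub (c i)
  cycleSub-vertex⁺ i = hv-decSub⁺ onCycle? cycleArc? (i , refl)

  cycleSub-arc⁻ : ∀ {x y} → Arc cycleSub x y → ∃[ i ] c i ≡ x × c (next i) ≡ y
  cycleSub-arc⁻ = ha-decSub⁻ onCycle? cycleArc?

  cycleSub-isCycle : Injective _≡_ _≡_ c → IsCycle cycleSub
  cycleSub-isCycle inj =
    k , c , inj ,
    (λ x → cycleSub-vertex⁻ , λ { i refl → cycleSub-vertex⁺ i }) ,
    (λ x y → cycleSub-arc⁻ , λ i e₁ e₂ → ha-decSub⁺ onCycle? cycleArc? (i , e₁ , e₂))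

-- Forks

module _ {A : Set} (R : A → A → Set) where

  Diverge : A → A → A → Set
  Diverge u v v′ = ∃[ w ] ∃[ w₁ ] ∃[ w₂ ]
    w₁ ≢ w₂ × R w w₁ × R w w₂ × Star R u w × Star R w₁ v × Star R w₂ v′

  Fork : Set
  Fork = ∃[ w ] ∃[ w₁ ] ∃[ w₂ ] w₁ ≢ w₂ × R w w₁ × R w w₂ × Star R w₁ w × Star R w₂ w

firstOr : {A : Set} → A → List A → A
firstOr b []      = b
firstOr _ (x ∷ _) = x

module _ {A : Set} {R : A → A → Set} where

  Diverge⇒Fork : ∀ {u v v′} → Diverge R u v v′ → Star R v u → Star R v′ u → Fork R
  Diverge⇒Fork (w , w₁ , w₂ , w₁≢w₂ , r₁ , r₂ , uw , w₁v , w₂v′) vu v′u =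
    w , w₁ , w₂ , w₁≢w₂ , r₁ , r₂ , w₁v ◅◅ vu ◅◅ uw , w₂v′ ◅◅ v′u ◅◅ uw

  module _ (q : A → Bool) where

    private
      separated : ∀ {x y} → q x ≡ true → q y ≡ false → x ≢ y
      separated qx qy refl with trans (sym qx) qy
      ... | ()

    -- the ends fail q and the internal vertices satisfy it, so neither walk is a proper
    -- prefix of the other
    Ch-diverge : DecidableEquality A → ∀ {u v v′} zs zs′ →
                 All (λ z → q z ≡ true) zs → All (λ z → q z ≡ true) zs′ →
                 q v ≡ false → q v′ ≡ false → Ch R u zs v → Ch R u zs′ v′ →
                 ¬ (zs ≡ zs′ × v ≡ v′) → Diverge R u v v′
    Ch-diverge _≟_ [] [] _ _ _ _ r r′ different =
      _ , _ , _ , (λ v≡v′ → different (refl , v≡v′)) , r , r′ , ε , ε , ε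
    Ch-diverge _≟_ [] (_ ∷ zs′) _ (qz′ ∷ _) qv _ r (r′ , c′) _ =
      _ , _ , _ , (λ e → separated qz′ qv (sym e)) , r , r′ , ε , ε , Ch⇒Star zs′ c′
    Ch-diverge _≟_ (_ ∷ zs) [] (qz ∷ _) _ _ qv′ (r , c) r′ _ =
      _ , _ , _ , separated qz qv′ , r , r′ , ε , Ch⇒Star zs c , ε
    Ch-diverge _≟_ (z ∷ zs) (z′ ∷ zs′) (qz ∷ qzs) (_ ∷ qzs′) qv qv′ (r , c) (r′ , c′) different
      with z ≟ z′
    ... | no z≢z′ = _ , _ , _ , z≢z′ , r , r′ , ε , Ch⇒Star zs c , Ch⇒Star zs′ c′
    ... | yes refl =
      let (w , w₁ , w₂ , w₁≢w₂ , r₁ , r₂ , zw , w₁v , w₂v′) =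
            Ch-diverge _≟_ zs zs′ qzs qzs′ qv qv′ c c′
              (λ { (refl , refl) → different (refl , refl) })
      in w , w₁ , w₂ , w₁≢w₂ , r₁ , r₂ , r ◅ zw , w₁v , w₂v′

    firstOutside : ∀ {w p u} → R w p → Star R p u → q u ≡ false →
                   ∃[ b ] ∃[ rs ] q b ≡ false × All (λ z → q z ≡ true) rs ×
                                  Ch R w rs b × firstOr b rs ≡ p
    firstOutside {p = p} r pu qu with q p in qp
    firstOutside {p = p} r pu       qu | false = p , [] , qp , [] , r , refl
    firstOutside {p = p} r ε        qu | true  with () ← trans (sym qp) qu
    firstOutside {p = p} r (r′ ◅ pu) qu | true  =
      let (b , rs , qb , qrs , c , _) = firstOutside r′ pu qu
      in b , p ∷ rs , qb , qp ∷ qrs , (r , c) , refl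

    -- a prefix walk a → w, recorded by how it extends walks out of w
    ChPrefix : A → List A → A → Set
    ChPrefix a ws w = ∀ {rs b} → Ch R w rs b → Ch R a (ws ++ rs) b

    lastOutside : ∀ {u w} → q u ≡ false → Star R u w →
                  ∃[ a ] ∃[ ws ] q a ≡ false × Star R u a ×
                                 All (λ z → q z ≡ true) ws × ChPrefix a ws w
    lastOutside {u} qu = go qu ε [] id ε
      where
      go : ∀ {a ws v w} → q a ≡ false → Star R u a → All (λ z → q z ≡ true) ws →
           ChPrefix a ws v → Star R u v → Star R v w →
           ∃[ a ] ∃[ ws ] q a ≡ false × Star R u a × All (λ z → q z ≡ true) ws × ChPrefix a ws w
      go qa ua qws pre uv ε = _ , _ , qa , ua , qws , pre
      go {a} {ws} qa ua qws pre uv (_◅_ {j = v₂} r rest) with q v₂ in qv₂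
      ... | false = go qv₂ (uv ◅◅ r ◅ ε) [] id (uv ◅◅ r ◅ ε) rest
      ... | true  = go qa ua (++⁺ qws (qv₂ ∷ [])) extend (uv ◅◅ r ◅ ε) rest
        where
        extend : ChPrefix a (ws ++ v₂ ∷ []) v₂
        extend {rs} {b} c = subst (λ l → Ch R a l b) (sym (++-assoc ws (v₂ ∷ []) rs)) (pre (r , c))

module _ {n : ℕ} {R : Fin n → Fin n → Set} where

  IsCycle-diverge : ∀ {O : Sub n} → IsCycle O → (∀ {a b} → Arc O a b → R a b) →
                    (q : Fin n → Bool) → (∀ {x} → Vtx O x → q x ≡ true) →
                    ∀ {z v} s → Vtx O z → All (λ x → q x ≡ true) s → q v ≡ false →
                    Ch R z s v → Diverge R z z v
  IsCycle-diverge {O} cyc toR q qO {z} {v} s hz qs qv c with IsCycle⇒outArc cyc hz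
  ... | o , ro = leave s qs c
    where
    ho : Vtx O o
    ho = proj₂ (IsCycle⇒ArcsJoinVertices cyc ro)
    oz : Star R o z
    oz = map toR (IsCycle⇒Star cyc ho hz)
    leave : ∀ s → All (λ x → q x ≡ true) s → Ch R z s v → Diverge R z z v
    leave [] _ r = z , o , v , (λ { refl → contradiction (trans (sym (qO ho)) qv) λ () }) ,
                   toR ro , r , ε , oz , ε
    leave (p ∷ s) (_ ∷ qs) (r , c) with o ≟ p
    ... | no o≢p   = z , o , p , o≢p , toR ro , r , ε , oz , Ch⇒Star s c
    ... | yes refl =
      let (w , w₁ , w₂ , w₁≢w₂ , r₁ , r₂ , ow , w₁o , w₂v) = IsCycle-diverge cyc toR q qO s ho qs qv c
      in w , w₁ , w₂ , w₁≢w₂ , r₁ , r₂ , r ◅ ow , w₁o ◅◅ oz , w₂v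

module _ {n : ℕ} {R : Fin n → Fin n → Set} (R? : ∀ x y → Dec (R x y)) where

  fork? : Dec (Fork R)
  fork? = any? λ w → any? λ w₁ → any? λ w₂ →
    ¬? (w₁ ≟ w₂) ×-dec R? w w₁ ×-dec R? w w₂ ×-dec star? R? w₁ w ×-dec star? R? w₂ w

  module Component (w : Fin n) where

    InComponent : Fin n → Set
    InComponent x = Star R w x × Star R x w

    private
      inComponent? : ∀ x → Dec (InComponent x)
      inComponent? x = star? R? w x ×-dec star? R? x w

      componentArc? : ∀ x y → Dec ((InComponent x × InComponent y) × R x y)
      componentArc? x y = (inComponent? x ×-dec inComponent? y) ×-dec R? x y

    component : Sub n
    component = decSub inComponent? componentArc?

    component-vertex : ∀ {x} → Vtx component x → InComponent x
    component-vertex = hv-decSub⁻ inComponent? componentArc?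

    component-arc : ∀ {x y} → Arc component x y → R x y
    component-arc = proj₂ ∘ ha-decSub⁻ inComponent? componentArc?

    component-arc⁺ : ∀ {x y} → Star R w x → Star R y w → R x y → Arc component x y
    component-arc⁺ wx yw r =
      ha-decSub⁺ inComponent? componentArc? (((wx , r ◅ yw) , (wx ◅◅ r ◅ ε , yw)) , r)

    restrict : ∀ {x y} → Star R w x → Star R y w → Star R x y → Star (Arc component) x y
    restrict wx yw ε        = ε
    restrict wx yw (r ◅ xy) = component-arc⁺ wx (xy ◅◅ yw) r ◅ restrict (wx ◅◅ r ◅ ε) yw xy

    component-arcsJoin : ArcsJoinVertices component
    component-arcsJoin a =
      let ((hx , hy) , _) = ha-decSub⁻ inComponent? componentArc? a
      in hv-decSub⁺ inComponent? componentArc? hx , hv-decSub⁺ inComponent? componentArc? hy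

    component-strong : Strong component
    component-strong =
      (w , hv-decSub⁺ inComponent? componentArc? (ε , ε)) ,
      λ x y hx hy _ → let (wx , xw) = component-vertex hx ; (wy , yw) = component-vertex hy
                      in restrict wx yw (xw ◅◅ wy)

    component-fork : ∀ {w₁ w₂} → w₁ ≢ w₂ → R w w₁ → R w w₂ → Star R w₁ w → Star R w₂ w →
                     ¬ Trivial component × ¬ IsCycle component
    component-fork {w₁} {w₂} w₁≢w₂ r₁ r₂ w₁w w₂w =
      (λ (_ , _ , _ , noArcs) → contradiction (trans (sym arc₁) (noArcs _ _)) λ ()) ,
      (λ cyc → w₁≢w₂ (IsCycle⇒OutDegree≤1 cyc arc₁ arc₂))
      where
      arc₁ : Arc component w w₁
      arc₁ = component-arc⁺ ε w₁w r₁
      arc₂ : Arc component w w₂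
      arc₂ = component-arc⁺ ε w₂w r₂

-- Z-walks in G and the torso

module _ {n : ℕ} where

  Edge : Adj n → Fin n → Fin n → Set
  Edge E x y = E x y ≡ true

  In : VSet n → Fin n → Set
  In X x = X x ≡ true

module _ {n : ℕ} (E : Adj n) where

  Chain⇒Ch : ∀ {u} zs {v} → Chain E u zs v → Ch (Edge E) u zs v
  Chain⇒Ch []       e       = e
  Chain⇒Ch (_ ∷ zs) (e , c) = e , Chain⇒Ch zs c

  Ch⇒Chain : ∀ {u} zs {v} → Ch (Edge E) u zs v → Chain E u zs v
  Ch⇒Chain []       e       = e
  Ch⇒Chain (_ ∷ zs) (e , c) = e , Ch⇒Chain zs c

module _ {n : ℕ} (E : Adj n) (Z : VSet n) where

  uniqueClosedZCh⇒cycle : ∀ {z} m → Unique (z ∷ m) → All (In Z) (z ∷ m) → Ch (Edge E) z m z →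
                          ∃[ O ] SubOf (toDigraph E [ Z ]) O × IsCycle O × Vtx O z
  uniqueClosedZCh⇒cycle {z} m u qs ch =
    cycleSub c , (vertices , arcs) , cycleSub-isCycle c (lookup-injective u) , cycleSub-vertex⁺ c zero
    where
    c : Fin (suc (length m)) → Fin n
    c = lookup (z ∷ m)
    inZ : ∀ i → In Z (c i)
    inZ i = All.lookup qs (∈-lookup i)
    vertices : ∀ x → Vtx (cycleSub c) x → V (toDigraph E [ Z ]) x
    vertices x hx with cycleSub-vertex⁻ c hx
    ... | i , refl = _ , inZ i
    arcs : ∀ x y → Arc (cycleSub c) x y →
           Vtx (cycleSub c) x × Vtx (cycleSub c) y × A (toDigraph E [ Z ]) x y
    arcs x y a with cycleSub-arc⁻ c a
    ... | i , refl , refl = cycleSub-vertex⁺ c i , cycleSub-vertex⁺ c (next i) ,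
                            Ch-cyclic m ch i , inZ i , inZ (next i)

  closedZCh⇒cycle : ∀ {z} m → All (In Z) (z ∷ m) → Ch (Edge E) z m z →
                    ∃[ O ] SubOf (toDigraph E [ Z ]) O × IsCycle O × Vtx O z
  closedZCh⇒cycle m qs ch =
    let (m′ , u , m′⊆m , ch′) = Ch-uniqueCycle _≟_ m (⋖-wellFounded m) ch
    in uniqueClosedZCh⇒cycle m′ u (head qs ∷ anti-mono m′⊆m (tail qs)) ch′

  module _ {a b : Fin n} (good : GoodArc E Z a b) where

    goodArc-zWalk≡path : ∀ zs → All (In Z) zs → Ch (Edge E) a zs b → zs ≡ proj₁ good
    goodArc-zWalk≡path zs = go zs (⋖-wellFounded zs)
      where
      go : ∀ zs → Acc _⋖_ zs → All (In Z) zs → Ch (Edge E) a zs b → zs ≡ proj₁ good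
      go zs (acc rec) qs ch with unique⊎duplicate _≟_ zs
      ... | inj₁ u = proj₁ (proj₂ (proj₂ good)) zs (qs , u , Ch⇒Chain E zs ch)
      ... | inj₂ (p , z , m , s , refl) =
        let (ch′ , loop) = Ch-removeLoop p m ch
            onPath = go (p ++ z ∷ s) (rec (removeLoop-⋖ p m s))
                        (anti-mono (removeLoop-⊆ p m) qs) ch′
            qzm = ++⁻ʳ p qs
            (O , sub , cyc , hz) = closedZCh⇒cycle m (head qzm ∷ ++⁻ˡ m (tail qzm)) loop
            avoids = proj₂ (proj₂ (proj₂ good)) O sub cyc z (subst (z ∈_) onPath (∈-++⁺ʳ p (here refl)))
        in contradiction (trans (sym hz) avoids) λ ()

    goodArc-zWalk-unique : ∀ {zs zs′ b′} → b ≡ b′ → All (In Z) zs → All (In Z) zs′ →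
                           Ch (Edge E) a zs b → Ch (Edge E) a zs′ b′ → zs ≡ zs′
    goodArc-zWalk-unique refl qs qs′ ch ch′ =
      trans (goodArc-zWalk≡path _ qs ch) (sym (goodArc-zWalk≡path _ qs′ ch′))

module _ {n : ℕ} (E : Adj n) (Z S : VSet n) (S-avoids-Z : ∀ x → Z x ≡ true → S x ≡ false) where

  _↝_ : Fin n → Fin n → Set
  x ↝ y = E x y ≡ true × S x ≡ false × S y ≡ false

  _↝?_ : ∀ x y → Dec (x ↝ y)
  x ↝? y = (E x y ≟ᵇ true) ×-dec (S x ≟ᵇ false) ×-dec (S y ≟ᵇ false)

  zCh⇒↝Ch : ∀ {u} zs {v} → S u ≡ false → S v ≡ false → All (In Z) zs →
            Ch (Edge E) u zs v → Ch _↝_ u zs v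
  zCh⇒↝Ch []       su sv _         e       = e , su , sv
  zCh⇒↝Ch (z ∷ zs) su sv (qz ∷ qs) (e , c) =
    (e , su , S-avoids-Z z qz) , zCh⇒↝Ch zs (S-avoids-Z z qz) sv qs c

  TorsoMinusS : Digraph n
  TorsoMinusS = torso E Z － S

  torsoArc⇒Star : ∀ {u v} → A TorsoMinusS u v → Star _↝_ u v
  torsoArc⇒Star ((_ , _ , zs , qs , _ , ch) , su , sv) =
    Ch⇒Star zs (zCh⇒↝Ch zs su sv qs (Chain⇒Ch E zs ch))

  ↝*-source : ∀ {x w} → Star _↝_ x w → S w ≡ false → S x ≡ false
  ↝*-source ε       sw = sw
  ↝*-source (r ◅ _) _  = proj₁ (proj₂ r)

  Fork⇒F : Fork _↝_ → ∃[ H ] InF (toDigraph E － S) H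
  Fork⇒F (w , w₁ , w₂ , w₁≢w₂ , r₁ , r₂ , w₁w , w₂w) =
    component , (vertices , arcs) , component-strong , component-fork w₁≢w₂ r₁ r₂ w₁w w₂w
    where
    open Component _↝?_ w
    vertices : ∀ x → Vtx component x → V (toDigraph E － S) x
    vertices x hx = _ , ↝*-source (proj₂ (component-vertex hx)) (proj₁ (proj₂ r₁))
    arcs : ∀ x y → Arc component x y → Vtx component x × Vtx component y × A (toDigraph E － S) x y
    arcs x y a = proj₁ (component-arcsJoin a) , proj₂ (component-arcsJoin a) , component-arc a

  zPath : ∀ {x y} → A TorsoMinusS x y → List (Fin n)
  zPath ((_ , _ , zs , _) , _) = zs

  module _ (noFork : ¬ Fork _↝_) where

    torsoArcs-agree : ∀ {x y₁ y₂} (a₁ : A TorsoMinusS x y₁) (a₂ : A TorsoMinusS x y₂) →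
                      Star _↝_ y₁ x → Star _↝_ y₂ x → zPath a₁ ≡ zPath a₂ × y₁ ≡ y₂
    torsoArcs-agree {x} {y₁} {y₂}
      ((_ , zy₁ , zs₁ , qs₁ , _ , ch₁) , sx , sy₁) ((_ , zy₂ , zs₂ , qs₂ , _ , ch₂) , _ , sy₂) back₁ back₂
      with ≡-dec _≟_ zs₁ zs₂ ×-dec (y₁ ≟ y₂)
    ... | yes agree  = agree
    ... | no differ = contradiction (Diverge⇒Fork diverge back₁ back₂) noFork
      where
      diverge : Diverge _↝_ x y₁ y₂
      diverge = Ch-diverge Z _≟_ zs₁ zs₂ qs₁ qs₂ zy₁ zy₂
                  (zCh⇒↝Ch zs₁ sx sy₁ qs₁ (Chain⇒Ch E zs₁ ch₁))
                  (zCh⇒↝Ch zs₂ sx sy₂ qs₂ (Chain⇒Ch E zs₂ ch₂)) differ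

    -- leaving a Z-cycle through z along the path towards y would fork, since y leads back to z
    zCycle-avoids-torsoPath : ∀ {x y} → S x ≡ false → Z y ≡ false → S y ≡ false → Star _↝_ y x →
                              ∀ p {z} s → All (In Z) (p ++ z ∷ s) → Ch (Edge E) x (p ++ z ∷ s) y →
                              ∀ O → SubOf (toDigraph E [ Z ]) O → IsCycle O → ¬ Vtx O z
    zCycle-avoids-torsoPath sx zy sy yx p {z} s qs ch O (inZ , arcsO) cyc hz =
      noFork (Diverge⇒Fork diverge ε (yx ◅◅ Ch⇒Star p (zCh⇒↝Ch p sx sz (++⁻ˡ p qs) c₁)))
      where
      sz : S z ≡ false
      sz = S-avoids-Z z (proj₂ (inZ z hz))
      c₁ = proj₁ (Ch-++⁻ p ch)
      c₂ = proj₂ (Ch-++⁻ p ch)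
      toArc : ∀ {a b} → Arc O a b → a ↝ b
      toArc r = let (_ , _ , e , za , zb) = arcsO _ _ r in e , S-avoids-Z _ za , S-avoids-Z _ zb
      diverge : Diverge _↝_ z z _
      diverge = IsCycle-diverge cyc toArc Z (λ h → proj₂ (inZ _ h)) s hz (tail (++⁻ʳ p qs)) zy
                  (zCh⇒↝Ch s sz sy (tail (++⁻ʳ p qs)) c₂)

    torsoArc-good : ∀ {x y} → A TorsoMinusS x y → Star _↝_ y x → GoodArc E Z x y
    torsoArc-good a@((zx , zy , zs , path@(qs , _ , ch)) , sx , sy) yx = zs , path , unique , avoid
      where
      unique : ∀ zs′ → IsZPath E Z _ _ zs′ → zs′ ≡ zs
      unique zs′ path′ = proj₁ (torsoArcs-agree ((zx , zy , zs′ , path′) , sx , sy) a yx yx)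
      avoid : ∀ O → SubOf (toDigraph E [ Z ]) O → IsCycle O → ∀ z → z ∈ zs → hv O z ≡ false
      avoid O sub cyc z z∈ with hv O z in hz | ∈-∃++ z∈
      ... | false | _ = refl
      ... | true  | p , s , refl =
        contradiction hz (zCycle-avoids-torsoPath sx zy sy yx p s qs (Chain⇒Ch E zs ch) O sub cyc)

    Fbad⇒GoodCycle : ∀ {H} → InFbad E Z TorsoMinusS H → GoodCycle E Z H
    Fbad⇒GoodCycle {H} (sub , strong , nontrivial , _) =
      functionalStrong⇒IsCycle arcsJoin outDegree≤1 strong nontrivial ,
      λ x y r → torsoArc-good (torsoArc r) (back r)
      where
      arcsJoin : ArcsJoinVertices H
      arcsJoin = SubOf⇒ArcsJoinVertices sub
      torsoArc : ∀ {x y} → Arc H x y → A TorsoMinusS x y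
      torsoArc r = proj₂ (proj₂ (proj₂ sub _ _ r))
      back : ∀ {x y} → Arc H x y → Star _↝_ y x
      back r = let (hx , hy) = arcsJoin r
               in concat (map (torsoArc⇒Star ∘ torsoArc) (Strong⇒Star strong hy hx))
      outDegree≤1 : OutDegree≤1 H
      outDegree≤1 r₁ r₂ = proj₂ (torsoArcs-agree (torsoArc r₁) (torsoArc r₂) (back r₁) (back r₂))

  Fbad⇒F : ∀ {H} → InFbad E Z TorsoMinusS H → ∃[ H′ ] InF (toDigraph E － S) H′
  Fbad⇒F fbad with fork? _↝?_
  ... | yes fork  = Fork⇒F fork
  ... | no noFork = contradiction (Fbad⇒GoodCycle noFork fbad) (proj₂ (proj₂ (proj₂ fbad)))

  module Image (H : Sub n) (sub : SubOf (toDigraph E － S) H) where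

    InImage : Fin n → Set
    InImage x = Vtx H x × Z x ≡ false

    ZArc : Fin n → Fin n → Set
    ZArc a b = Arc H a b × In Z a

    ImArc : Fin n → Fin n → Set
    ImArc x y = ∃[ w ] Arc H x w × Star ZArc w y

    private
      inImage? : ∀ x → Dec (InImage x)
      inImage? x = (hv H x ≟ᵇ true) ×-dec (Z x ≟ᵇ false)

      imageArc? : ∀ x y → Dec ((InImage x × InImage y) × ImArc x y)
      imageArc? x y = (inImage? x ×-dec inImage? y) ×-dec
        any? (λ w → (ha H x w ≟ᵇ true) ×-dec
                     star? (λ a b → (ha H a b ≟ᵇ true) ×-dec (Z a ≟ᵇ true)) w y)

    image : Sub n
    image = decSub inImage? imageArc?

    image-vertex⁻ : ∀ {x} → Vtx image x → InImage x
    image-vertex⁻ = hv-decSub⁻ inImage? imageArc?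

    image-vertex⁺ : ∀ {x} → InImage x → Vtx image x
    image-vertex⁺ = hv-decSub⁺ inImage? imageArc?

    image-arc⁻ : ∀ {x y} → Arc image x y → (InImage x × InImage y) × ImArc x y
    image-arc⁻ = ha-decSub⁻ inImage? imageArc?

    image-arc⁺ : ∀ {x y} → InImage x → InImage y → ImArc x y → Arc image x y
    image-arc⁺ ix iy ia = ha-decSub⁺ inImage? imageArc? ((ix , iy) , ia)

    arcsJoin : ArcsJoinVertices H
    arcsJoin = SubOf⇒ArcsJoinVertices sub

    vertex-S : ∀ {x} → Vtx H x → S x ≡ false
    vertex-S h = proj₂ (proj₁ sub _ h)

    toEdge : ∀ {a b} → Arc H a b → Edge E a b
    toEdge r = proj₁ (proj₂ (proj₂ (proj₂ sub _ _ r)))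

    ImArc⇒Ch : ∀ {x y} → ImArc x y → ∃[ zs ] All (In Z) zs × Ch (Arc H) x zs y
    ImArc⇒Ch (_ , r , rest) = go r rest
      where
      go : ∀ {x w y} → Arc H x w → Star ZArc w y → ∃[ zs ] All (In Z) zs × Ch (Arc H) x zs y
      go r ε                  = [] , [] , r
      go r ((r′ , zw) ◅ rest) = let (zs , qs , c) = go r′ rest in _ ∷ zs , zw ∷ qs , r , c

    Ch⇒ImArc : ∀ {x y} zs → All (In Z) zs → Ch (Arc H) x zs y → ImArc x y
    Ch⇒ImArc []       []        r       = _ , r , ε
    Ch⇒ImArc (z ∷ zs) (qz ∷ qs) (r , c) =
      let (_ , r′ , rest) = Ch⇒ImArc zs qs c in z , r , (r′ , qz) ◅ rest

    image-sub : SubOf TorsoMinusS image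
    image-sub = vertices , arcs
      where
      vertices : ∀ x → Vtx image x → V TorsoMinusS x
      vertices x hx = let (h , zx) = image-vertex⁻ hx in zx , vertex-S h
      arcs : ∀ x y → Arc image x y → Vtx image x × Vtx image y × A TorsoMinusS x y
      arcs x y a =
        let ((ix , iy) , ia) = image-arc⁻ a
            (zs , qs , c) = ImArc⇒Ch ia
            (zs′ , u , zs′⊆zs , c′) = Ch-unique _≟_ zs (⋖-wellFounded zs) (Ch-map toEdge zs c)
        in image-vertex⁺ ix , image-vertex⁺ iy ,
           ((proj₂ ix , proj₂ iy , zs′ , anti-mono zs′⊆zs qs , u , Ch⇒Chain E zs′ c′) ,
            vertex-S (proj₁ ix) , vertex-S (proj₁ iy))

    -- an H-walk leaving x by an arc is read off as an image walk, cut at its vertices outside Z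
    image-extend : ∀ {x w y} → InImage x → ImArc x w → Star (Arc H) w y →
                   ∃[ a ] InImage a × Star (Arc image) x a × ImArc a y
    image-extend ix ia ε = _ , ix , ε , ia
    image-extend {w = w} ix (w′ , r′ , zs) (r ◅ rest) with Z w in zw
    ... | true  = image-extend ix (w′ , r′ , zs ◅◅ (r , zw) ◅ ε) rest
    ... | false =
      let iw = proj₁ (arcsJoin r) , zw
          (a , ia , wa , ay) = image-extend iw (_ , r , ε) rest
      in a , ia , image-arc⁺ ix iw (w′ , r′ , zs) ◅ wa , ay

    module _ (strong : Strong H) {u} (iu : InImage u) where

      image-strong : Strong image
      image-strong = (u , image-vertex⁺ iu) , λ x y hx hy x≢y →
        walk (image-vertex⁻ hx) (image-vertex⁻ hy)
             (proj₂ strong x y (proj₁ (image-vertex⁻ hx)) (proj₁ (image-vertex⁻ hy)) x≢y) x≢y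
        where
        walk : ∀ {x y} → InImage x → InImage y → Star (Arc H) x y → x ≢ y → Star (Arc image) x y
        walk ix iy ε          x≢y = contradiction refl x≢y
        walk ix iy (r ◅ rest) _   =
          let (a , ia , xa , ay) = image-extend ix (_ , r , ε) rest in xa ◅◅ image-arc⁺ ia iy ay ◅ ε

      image-nontrivial : ¬ Trivial H → ¬ Trivial image
      image-nontrivial nontrivial (_ , _ , _ , noArcs) =
        let (w , r) = Strong⇒outArc strong nontrivial arcsJoin (proj₁ iu)
            (a , ia , _ , au) = image-extend iu (w , r , ε)
                                  (Strong⇒Star strong (proj₂ (arcsJoin r)) (proj₁ iu))
        in contradiction (trans (sym (image-arc⁺ ia iu au)) (noArcs a u)) λ ()

      -- at a branching w → p₁, p₂ of H, the last vertex a outside Z before w and the first ones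
      -- b₁, b₂ after p₁, p₂ give image arcs a → b₁, a → b₂; in a good cycle they coincide
      goodImage⇒OutDegree≤1 : GoodCycle E Z image → OutDegree≤1 H
      goodImage⇒OutDegree≤1 (cyc , good) {w} {p₁} {p₂} r₁ r₂ =
        let (hu , zu) = iu
            (a , ws , za , ua , qws , pre) = lastOutside Z zu (Strong⇒Star strong hu (proj₁ (arcsJoin r₁)))
            ia = Star-vertex arcsJoin ua hu , za
            (b₁ , rs₁ , zb₁ , qrs₁ , c₁ , first₁) = leave r₁
            (b₂ , rs₂ , zb₂ , qrs₂ , c₂ , first₂) = leave r₂
            arc₁ = image-arc⁺ ia (Star-vertex arcsJoin (Ch⇒Star (ws ++ rs₁) (pre c₁)) (proj₁ ia) , zb₁)
                     (Ch⇒ImArc (ws ++ rs₁) (++⁺ qws qrs₁) (pre c₁))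
            arc₂ = image-arc⁺ ia (Star-vertex arcsJoin (Ch⇒Star (ws ++ rs₂) (pre c₂)) (proj₁ ia) , zb₂)
                     (Ch⇒ImArc (ws ++ rs₂) (++⁺ qws qrs₂) (pre c₂))
            b₁≡b₂ = IsCycle⇒OutDegree≤1 cyc arc₁ arc₂
            rs₁≡rs₂ = ++-cancelˡ ws rs₁ rs₂
                        (goodArc-zWalk-unique E Z (good a b₁ arc₁) b₁≡b₂ (++⁺ qws qrs₁) (++⁺ qws qrs₂)
                           (Ch-map toEdge (ws ++ rs₁) (pre c₁)) (Ch-map toEdge (ws ++ rs₂) (pre c₂)))
        in trans (sym first₁) (trans (cong₂ firstOr b₁≡b₂ rs₁≡rs₂) first₂)
        where
        leave : ∀ {p} → Arc H w p → ∃[ b ] ∃[ rs ] Z b ≡ false × All (In Z) rs ×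
                                                  Ch (Arc H) w rs b × firstOr b rs ≡ p
        leave r = firstOutside Z r (Strong⇒Star strong (proj₂ (arcsJoin r)) (proj₁ iu)) (proj₂ iu)

  F⇒Fbad : ∀ T → (∀ H → ¬ InF (toDigraph E [ Z ∪ T ]) H) →
           ∀ {H} → InF (toDigraph E － S) H → ∃[ H′ ] InFbad E Z TorsoMinusS H′
  F⇒Fbad T noF {H} f@(sub , strong , nontrivial , notCycle)
    with any? (λ u → (hv H u ≟ᵇ true) ×-dec (Z u ≟ᵇ false))
  ... | yes (u , iu) =
    image , image-sub , image-strong strong iu , image-nontrivial strong iu nontrivial ,
    λ good → notCycle (functionalStrong⇒IsCycle arcsJoin (goodImage⇒OutDegree≤1 strong iu good)
                                                strong nontrivial)
    where open Image H sub
  ... | no outsideZ = contradiction (insideZ∪T , proj₂ f) (noF H)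
    where
    inZ∪T : ∀ x → Vtx H x → (Z ∪ T) x ≡ true
    inZ∪T x hx with Z x in zx
    ... | true  = refl
    ... | false = contradiction (x , hx , zx) outsideZ
    insideZ∪T : SubOf (toDigraph E [ Z ∪ T ]) H
    insideZ∪T = (λ x hx → _ , inZ∪T x hx) ,
                (λ x y r → let (hx , hy , e , _) = proj₂ sub x y r in hx , hy , e , inZ∪T x hx , inZ∪T y hy)

lemma6 : ∀ {n} (E : Adj n) (k : ℕ) (T Z : VSet n) →
    NontrivCompsOutRegular (toDigraph E － T) →
    (∀ x → Z x ≡ true → T x ≡ false) →
    (∀ H → ¬ InF (toDigraph E [ Z ∪ T ]) H) →
    ∀ (S : VSet n) → (∀ x → S x ≡ true → Z x ≡ false × T x ≡ false) →
    (∃[ H ] InF (toDigraph E － S) H) ⇔ (∃[ H ] InFbad E Z (torso E Z － S) H)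
lemma6 E _ T Z _ _ noF S S-outside =
  mk⇔ (λ (_ , f) → F⇒Fbad E Z S S-avoids-Z T noF f) (λ (_ , fbad) → Fbad⇒F E Z S S-avoids-Z fbad)
  where
  S-avoids-Z : ∀ x → Z x ≡ true → S x ≡ false
  S-avoids-Z x zx with S x in sx
  ... | false = refl
  ... | true  = contradiction (trans (sym zx) (proj₁ (S-outside x sx))) λ ()
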